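{- Let $f:\mathbb{N}\to\mathbb{C}$ be an arbitrary arithmetic function and for $n\in\mathbb{N}$ let $M_f(n)=\sum_{a=1,\,(a,n)=1}^{n} f((a-1,n))$. Then for every $n\in\mathbb{N}$, \[ M_f(n)=\big(\mathrm{id}*(\mu\times(\mu*f))\big)(n)=\sum_{\delta\mid n}\frac{n}{\delta}\sum_{\substack{de=\delta\\ (d,e)=1}}\mu(d)\,(\mu*f)(e). \]
   Context: $(x,y)$ denotes the greatest common divisor (with $(0,n)=n$). $\mathrm{id}(n)=n$, $\mu$ is the Möbius function, $(g*h)(n)=\sum_{d\mid n}g(d)h(n/d)$ is the Dirichlet convolution and $(g\times h)(n)=\sum_{d\mid n,\,(d,n/d)=1}g(d)h(n/d)$ is the unitary convolution. -}

module Defs where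

open import Level using (Level)
open import Algebra.Bundles using (CommutativeRing)
open import Data.Nat using (ℕ; zero; suc; _≟_; _≤?_)
import Data.Nat as ℕ
open import Data.Nat.GCD using (gcd)
open import Data.Nat.Divisibility using (_∣?_)
open import Data.Nat.Primality using (prime?)
open import Data.Integer using (ℤ; +_; -[1+_])
open import Data.List using (List; []; _∷_; foldr; map; filter; concatMap; length)
open import Data.Bool.ListAction using (any)
open import Data.List.Base using (upTo)
open import Data.Product using (_×_; _,_)
open import Relation.Nullary.Decidable using (does; ⌊_⌋)
open import Data.Bool using (Bool; true; false; if_then_else_; _∧_)

range1 : ℕ → List ℕ
range1 n = map suc (upTo n)

factorPairs : ℕ → List (ℕ × ℕ)
factorPairs n =
  filter (λ p → let (d , e) = p in d ℕ.* e ≟ n)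
         (concatMap (λ d → map (λ e → (d , e)) (range1 n)) (range1 n))

isSquarefree : ℕ → Bool
isSquarefree n = Data.Bool.not (any (λ d → ⌊ (d ℕ.* d) ∣? n ⌋) (map suc (range1 n)))
  where import Data.Bool

ω : ℕ → ℕ
ω n = length (filter (λ p → prime? p) (filter (λ p → p ∣? n) (range1 n)))

-- Möbius function (value at 0 is irrelevant; only evaluated at n ≥ 1)
μ : ℕ → ℤ
μ n = if isSquarefree n then sgn (ω n) else + 0
  where
  sgn : ℕ → ℤ
  sgn zero = + 1
  sgn (suc zero) = -[1+ 0 ]
  sgn (suc (suc k)) = sgn k

module Arith {c ℓ : Level} (R : CommutativeRing c ℓ) where
  open CommutativeRing R

  Σ : List Carrier → Carrier
  Σ = foldr _+_ 0#

  fromℕ : ℕ → Carrier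
  fromℕ zero = 0#
  fromℕ (suc n) = 1# + fromℕ n

  fromℤ : ℤ → Carrier
  fromℤ (+ n) = fromℕ n
  fromℤ -[1+ n ] = - fromℕ (suc n)

  ArithFun : Set c
  ArithFun = ℕ → Carrier

  idA : ArithFun
  idA n = fromℕ n

  μA : ArithFun
  μA n = fromℤ (μ n)

  _⋆_ : ArithFun → ArithFun → ArithFun
  (g ⋆ h) n = Σ (map (λ p → let (d , e) = p in g d * h e) (factorPairs n))

  _⊠_ : ArithFun → ArithFun → ArithFun
  (g ⊠ h) n = Σ (map (λ p → let (d , e) = p in g d * h e)
                    (filter (λ p → let (d , e) = p in gcd d e ≟ 1) (factorPairs n)))

  M : ArithFun → ArithFun
  M f n = Σ (map (λ a → f (gcd (a ℕ.∸ 1) n)) (filter (λ a → gcd a n ≟ 1) (range1 n)))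

{-# OPTIONS --safe #-}
-- Write [(a, n) = 1] = Σ_{d ∣ (a, n)} μ(d) and f((a - 1, n)) = Σ_{e ∣ (a - 1, n)} (μ ⋆ f)(e). Exchanging
-- the summations,
--   M_f(n) = Σ_{d, e ∣ n} μ(d) (μ ⋆ f)(e) · #{1 ≤ a ≤ n : a ≡ 0 (mod d), a ≡ 1 (mod e)}.
-- A solution a forces (d, e) = 1, and for coprime d and e the Chinese remainder theorem puts exactly one
-- solution in every block of d e consecutive integers, so the count is [(d, e) = 1] · n / (d e).
-- Unfolding the right-hand side leads to the same double sum Σ_{(d, e) = 1, d e ∣ n} μ(d) (μ ⋆ f)(e) · n / (d e).
module Submission where

open import Algebra.Bundles using (CommutativeMonoid; CommutativeRing)
open import Data.Bool using (Bool; true; false; T; not; if_then_else_)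
open import Data.Bool.ListAction using (any)
open import Data.Bool.Properties using (T-≡)
open import Data.Empty using (⊥-elim)
open import Data.Integer using (ℤ; +_; -[1+_])
import Data.Integer as ℤ
open import Data.List using (List; []; _∷_; _++_; [_]; map; foldr; filter; concatMap; length)
open import Data.List.Base using (upTo)
open import Data.List.Membership.Propositional using (find; lose)
open import Data.List.Membership.Propositional.Properties using (∈-map⁺; ∈-map⁻; ∈-upTo⁺)
open import Data.List.Properties using (map-++; upTo-∷ʳ; map-cong; map-∘)
open import Data.List.Relation.Unary.All using (_∷_)
open import Data.List.Relation.Unary.Any.Properties using (any⁺; any⁻)
open import Data.Nat using (ℕ; zero; suc; pred; _+_; _*_; _∸_; _≤_; _<_; z≤n; s≤s; _≟_; _≤?_; NonZero; >-nonZero; >-nonZero⁻¹)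
open import Data.Nat.Coprimality using (Coprime; coprime-divisor; coprime-Bézout; gcd≡1⇒coprime)
import Data.Nat.Coprimality as Coprimality
open import Data.Nat.Divisibility
open import Data.Nat.DivMod using (_%_; _/_; m≡m%n+[m/n]*n; m%n<n)
open import Data.Nat.GCD using (gcd; gcd[m,n]∣m; gcd[m,n]∣n; gcd-greatest; gcd[m,n]≡0⇒n≡0; module Bézout)
open import Data.Nat.ListAction using (product)
open import Data.Nat.Primality using (Prime; prime?; euclidsLemma; prime⇒irreducible; prime⇒nonZero; ¬prime[1])
open import Data.Nat.Primality.Factorisation using (factorise)
open import Data.Nat.Properties
import Data.Nat.Properties as ℕₚ
open import Data.Nat.Solver using (module +-*-Solver)
open +-*-Solver using (solve; _:+_; _:*_; _:=_)
open import Data.Product using (∃; _,_; _×_; proj₁; proj₂)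
open import Data.Sum using (inj₁; inj₂; [_,_]′)
open import Function using (id; _∘_)
open import Function.Bundles using (Equivalence; _⇔_; mk⇔)
open import Relation.Binary.PropositionalEquality as ≡ using (_≡_; _≢_; ≢-sym)
open import Relation.Nullary using (Dec; yes; no; ¬_)
open import Relation.Nullary.Decidable using (¬?; _×-dec_; ⌊_⌋; toWitness; fromWitness)

open import Defs

module FiniteSums {c ℓ} (M : CommutativeMonoid c ℓ) where
  open CommutativeMonoid M renaming (Carrier to C)
  open import Algebra.Properties.CommutativeSemigroup commutativeSemigroup using (interchange)
  open import Relation.Binary.Reasoning.Setoid setoid

  sumList : List C → C
  sumList = foldr _∙_ ε

  sumTo : ℕ → (ℕ → C) → C
  sumTo n F = sumList (map F (range1 n))

  when : ∀ {p} {A : Set p} → Dec A → C → C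
  when (yes _) x = x
  when (no _)  _ = ε

  sumDivisors : ℕ → (ℕ → C) → C
  sumDivisors n F = sumTo n (λ d → when (d ∣? n) (F d))

  when-yes : ∀ {p} {A : Set p} (a? : Dec A) {x} → A → when a? x ≈ x
  when-yes (yes _) _ = refl
  when-yes (no ¬a) a = ⊥-elim (¬a a)

  when-no : ∀ {p} {A : Set p} (a? : Dec A) {x} → ¬ A → when a? x ≈ ε
  when-no (yes a) ¬a = ⊥-elim (¬a a)
  when-no (no _)  _  = refl

  when-cong : ∀ {p} {A : Set p} (a? : Dec A) {x y} → (A → x ≈ y) → when a? x ≈ when a? y
  when-cong (yes a) x≈y = x≈y a
  when-cong (no _)  _   = refl

  when-ε : ∀ {p} {A : Set p} (a? : Dec A) → when a? ε ≈ ε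
  when-ε (yes _) = refl
  when-ε (no _)  = refl

  when-⇔ : ∀ {p q} {A : Set p} {B : Set q} (a? : Dec A) (b? : Dec B) {x} →
           (A → B) → (B → A) → when a? x ≈ when b? x
  when-⇔ (yes _) (yes _) _ _ = refl
  when-⇔ (yes a) (no ¬b) f _ = ⊥-elim (¬b (f a))
  when-⇔ (no ¬a) (yes b) _ g = ⊥-elim (¬a (g b))
  when-⇔ (no _)  (no _)  _ _ = refl

  when-split : ∀ {p} {A : Set p} (a? : Dec A) x → x ≈ when a? x ∙ when (¬? a?) x
  when-split (yes _) x = sym (identityʳ x)
  when-split (no _)  x = sym (identityˡ x)

  when-comm : ∀ {p q} {A : Set p} {B : Set q} (a? : Dec A) (b? : Dec B) x → when a? (when b? x) ≈ when b? (when a? x)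
  when-comm (yes _) b? x = refl
  when-comm (no _)  b? x = sym (when-ε b?)

  when-× : ∀ {p q r} {A : Set p} {B : Set q} {D : Set r} (d? : Dec D) (a? : Dec A) (b? : Dec B) {x} →
           (D → A × B) → (A → B → D) → when d? x ≈ when a? (when b? x)
  when-× (yes d) a? b? to _ = sym (trans (when-yes a? (proj₁ (to d))) (when-yes b? (proj₂ (to d))))
  when-× (no ¬d) (yes a) (yes b) _ from = ⊥-elim (¬d (from a b))
  when-× (no _)  (yes _) (no _)  _ _    = refl
  when-× (no _)  (no _)  _       _ _    = refl

  sumList-++ : ∀ xs ys → sumList (xs ++ ys) ≈ sumList xs ∙ sumList ys
  sumList-++ []       ys = sym (identityˡ _)
  sumList-++ (x ∷ xs) ys = trans (∙-congˡ (sumList-++ xs ys)) (sym (assoc _ _ _))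

  sumTo-suc : ∀ n F → sumTo (suc n) F ≈ sumTo n F ∙ F (suc n)
  sumTo-suc n F = begin
    sumList (map F (range1 (suc n)))     ≡⟨ ≡.cong (λ l → sumList (map F l)) range1-suc ⟩
    sumList (map F (range1 n ++ [ suc n ])) ≡⟨ ≡.cong sumList (map-++ F (range1 n) _) ⟩
    sumList (map F (range1 n) ++ [ F (suc n) ]) ≈⟨ sumList-++ (map F (range1 n)) _ ⟩
    sumTo n F ∙ (F (suc n) ∙ ε)           ≈⟨ ∙-congˡ (identityʳ _) ⟩
    sumTo n F ∙ F (suc n)                 ∎
    where
    range1-suc : range1 (suc n) ≡ range1 n ++ [ suc n ]
    range1-suc = ≡.trans (≡.cong (map suc) (≡.sym (upTo-∷ʳ n))) (map-++ suc (upTo n) [ n ])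

  sumTo-cong : ∀ n {F G : ℕ → C} → (∀ i → 1 ≤ i → i ≤ n → F i ≈ G i) → sumTo n F ≈ sumTo n G
  sumTo-cong zero    _   = refl
  sumTo-cong (suc n) {F} {G} F≈G = begin
    sumTo (suc n) F       ≈⟨ sumTo-suc n F ⟩
    sumTo n F ∙ F (suc n) ≈⟨ ∙-cong (sumTo-cong n (λ i 1≤i i≤n → F≈G i 1≤i (m≤n⇒m≤1+n i≤n)))
                                    (F≈G (suc n) (s≤s z≤n) ≤-refl) ⟩
    sumTo n G ∙ G (suc n) ≈⟨ sym (sumTo-suc n G) ⟩
    sumTo (suc n) G       ∎

  sumTo-ε : ∀ n {F : ℕ → C} → (∀ i → 1 ≤ i → i ≤ n → F i ≈ ε) → sumTo n F ≈ ε
  sumTo-ε n {F} F≈ε = trans (sumTo-cong n F≈ε) (const-ε n)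
    where
    const-ε : ∀ n → sumTo n (λ _ → ε) ≈ ε
    const-ε zero    = refl
    const-ε (suc n) = trans (sumTo-suc n _) (trans (identityʳ _) (const-ε n))

  sumTo-∙ : ∀ n (F G : ℕ → C) → sumTo n (λ i → F i ∙ G i) ≈ sumTo n F ∙ sumTo n G
  sumTo-∙ zero    F G = sym (identityˡ ε)
  sumTo-∙ (suc n) F G = begin
    sumTo (suc n) (λ i → F i ∙ G i)                   ≈⟨ sumTo-suc n _ ⟩
    sumTo n (λ i → F i ∙ G i) ∙ (F (suc n) ∙ G (suc n)) ≈⟨ ∙-congʳ (sumTo-∙ n F G) ⟩
    (sumTo n F ∙ sumTo n G) ∙ (F (suc n) ∙ G (suc n))   ≈⟨ interchange _ _ _ _ ⟩
    (sumTo n F ∙ F (suc n)) ∙ (sumTo n G ∙ G (suc n))   ≈⟨ sym (∙-cong (sumTo-suc n F) (sumTo-suc n G)) ⟩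
    sumTo (suc n) F ∙ sumTo (suc n) G                   ∎

  sumTo-+ : ∀ m k (F : ℕ → C) → sumTo (m + k) F ≈ sumTo m F ∙ sumTo k (λ j → F (m + j))
  sumTo-+ m zero    F = begin
    sumTo (m + zero) F ≡⟨ ≡.cong (λ t → sumTo t F) (+-identityʳ m) ⟩
    sumTo m F          ≈⟨ sym (identityʳ _) ⟩
    sumTo m F ∙ ε      ∎
  sumTo-+ m (suc k) F = begin
    sumTo (m + suc k) F                                     ≡⟨ ≡.cong (λ t → sumTo t F) (+-suc m k) ⟩
    sumTo (suc (m + k)) F                                   ≈⟨ sumTo-suc (m + k) F ⟩
    sumTo (m + k) F ∙ F (suc (m + k))                       ≈⟨ ∙-congʳ (sumTo-+ m k F) ⟩
    (sumTo m F ∙ sumTo k (λ j → F (m + j))) ∙ F (suc (m + k)) ≈⟨ assoc _ _ _ ⟩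
    sumTo m F ∙ (sumTo k (λ j → F (m + j)) ∙ F (suc (m + k)))
      ≡⟨ ≡.cong (λ t → sumTo m F ∙ (sumTo k (λ j → F (m + j)) ∙ F t)) (≡.sym (+-suc m k)) ⟩
    sumTo m F ∙ (sumTo k (λ j → F (m + j)) ∙ F (m + suc k)) ≈⟨ ∙-congˡ (sym (sumTo-suc k (λ j → F (m + j)))) ⟩
    sumTo m F ∙ sumTo (suc k) (λ j → F (m + j))             ∎

  sumTo-extend : ∀ {m n} (F : ℕ → C) → m ≤ n → (∀ i → m < i → i ≤ n → F i ≈ ε) → sumTo n F ≈ sumTo m F
  sumTo-extend {m} F m≤n F≈ε with m≤n⇒∃[o]m+o≡n m≤n
  ... | k , ≡.refl = begin
    sumTo (m + k) F                         ≈⟨ sumTo-+ m k F ⟩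
    sumTo m F ∙ sumTo k (λ j → F (m + j))
      ≈⟨ ∙-congˡ (sumTo-ε k (λ j 1≤j j≤k → F≈ε (m + j) (m<m+n m 1≤j) (+-monoʳ-≤ m j≤k))) ⟩
    sumTo m F ∙ ε                           ≈⟨ identityʳ _ ⟩
    sumTo m F                               ∎

  sumTo-single : ∀ {n} k (F : ℕ → C) → 1 ≤ k → k ≤ n → (∀ i → 1 ≤ i → i ≤ n → i ≢ k → F i ≈ ε) →
                 sumTo n F ≈ F k
  sumTo-single {zero}  k F 1≤k k≤0 _ = ⊥-elim (<⇒≱ 1≤k k≤0)
  sumTo-single {suc n} k F 1≤k k≤1+n F≈ε with k ≟ suc n
  ... | yes ≡.refl = begin
    sumTo (suc n) F       ≈⟨ sumTo-suc n F ⟩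
    sumTo n F ∙ F (suc n) ≈⟨ ∙-congʳ (sumTo-ε n (λ i 1≤i i≤n →
                               F≈ε i 1≤i (m≤n⇒m≤1+n i≤n) (<⇒≢ (s≤s i≤n)))) ⟩
    ε ∙ F (suc n)         ≈⟨ identityˡ _ ⟩
    F (suc n)             ∎
  ... | no k≢1+n = begin
    sumTo (suc n) F       ≈⟨ sumTo-suc n F ⟩
    sumTo n F ∙ F (suc n) ≈⟨ ∙-cong (sumTo-single k F 1≤k (≤-pred (≤∧≢⇒< k≤1+n k≢1+n))
                                      (λ i 1≤i i≤n → F≈ε i 1≤i (m≤n⇒m≤1+n i≤n)))
                                    (F≈ε (suc n) (s≤s z≤n) ≤-refl (≢-sym k≢1+n)) ⟩
    F k ∙ ε               ≈⟨ identityʳ _ ⟩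
    F k                   ∎

  sumTo-≟ : ∀ {n k} (F : ℕ → C) → 1 ≤ k → (n < k → F k ≈ ε) → sumTo n (λ i → when (k ≟ i) (F i)) ≈ F k
  sumTo-≟ {n} {k} F 1≤k F≈ε with k ≤? n
  ... | yes k≤n = trans (sumTo-single k _ 1≤k k≤n (λ i _ _ i≢k → when-no (k ≟ i) (≢-sym i≢k))) (when-yes (k ≟ k) ≡.refl)
  ... | no  k≰n = trans (sumTo-ε n (λ i _ i≤n → when-no (k ≟ i) (λ k≡i → k≰n (≡.subst (_≤ n) (≡.sym k≡i) i≤n))))
                        (sym (F≈ε (≰⇒> k≰n)))

  sumTo-comm : ∀ n m (F : ℕ → ℕ → C) →
               sumTo n (λ i → sumTo m (λ j → F i j)) ≈ sumTo m (λ j → sumTo n (λ i → F i j))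
  sumTo-comm zero    m F = sym (sumTo-ε m (λ _ _ _ → refl))
  sumTo-comm (suc n) m F = begin
    sumTo (suc n) (λ i → sumTo m (F i))                          ≈⟨ sumTo-suc n _ ⟩
    sumTo n (λ i → sumTo m (F i)) ∙ sumTo m (F (suc n))           ≈⟨ ∙-congʳ (sumTo-comm n m F) ⟩
    sumTo m (λ j → sumTo n (λ i → F i j)) ∙ sumTo m (F (suc n))   ≈⟨ sym (sumTo-∙ m _ _) ⟩
    sumTo m (λ j → sumTo n (λ i → F i j) ∙ F (suc n) j)           ≈⟨ sumTo-cong m (λ j _ _ → sumTo-suc n (λ i → F i j)) ⟨
    sumTo m (λ j → sumTo (suc n) (λ i → F i j))                   ∎

  sumTo-rotate : ∀ n (F : ℕ → ℕ → ℕ → C) →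
    sumTo n (λ i → sumTo n (λ j → sumTo n (λ l → F i j l))) ≈ sumTo n (λ j → sumTo n (λ l → sumTo n (λ i → F i j l)))
  sumTo-rotate n F = trans (sumTo-comm n n _) (sumTo-cong n (λ j _ _ → sumTo-comm n n _))

  sumTo-divisors : ∀ {k n} (F : ℕ → C) → 1 ≤ k → k ≤ n → sumTo n (λ d → when (d ∣? k) (F d)) ≈ sumDivisors k F
  sumTo-divisors {k} F 1≤k k≤n = sumTo-extend _ k≤n
    (λ i k<i _ → when-no (i ∣? k) (λ i∣k → <⇒≱ k<i (∣⇒≤ {{>-nonZero 1≤k}} i∣k)))

  when-sumTo : ∀ {p} {A : Set p} (a? : Dec A) n (F : ℕ → C) → when a? (sumTo n F) ≈ sumTo n (λ i → when a? (F i))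
  when-sumTo (yes _) n F = refl
  when-sumTo (no _)  n F = sym (sumTo-ε n (λ _ _ _ → refl))

  sumList-filter : ∀ {a p} {A : Set a} {P : A → Set p} (P? : ∀ x → Dec (P x)) (h : A → C) xs →
                   sumList (map h (filter P? xs)) ≈ sumList (map (λ x → when (P? x) (h x)) xs)
  sumList-filter P? h [] = refl
  sumList-filter P? h (x ∷ xs) with P? x
  ... | yes _ = ∙-congˡ (sumList-filter P? h xs)
  ... | no _  = trans (sumList-filter P? h xs) (sym (identityˡ _))

  sumList-concatMap : ∀ {a b} {A : Set a} {B : Set b} (g : A → List B) (h : B → C) xs →
                      sumList (map h (concatMap g xs)) ≈ sumList (map (λ x → sumList (map h (g x))) xs)
  sumList-concatMap g h [] = refl
  sumList-concatMap g h (x ∷ xs) = begin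
    sumList (map h (g x ++ concatMap g xs))                 ≡⟨ ≡.cong sumList (map-++ h (g x) _) ⟩
    sumList (map h (g x) ++ map h (concatMap g xs))         ≈⟨ sumList-++ (map h (g x)) _ ⟩
    sumList (map h (g x)) ∙ sumList (map h (concatMap g xs)) ≈⟨ ∙-congˡ (sumList-concatMap g h xs) ⟩
    sumList (map (λ x → sumList (map h (g x))) (x ∷ xs))    ∎

-- The Möbius function

sign : ℕ → ℤ
sign zero          = + 1
sign (suc zero)    = -[1+ 0 ]
sign (suc (suc k)) = sign k

sign-suc : ∀ k → sign (suc k) ≡ ℤ.- sign k
sign-suc zero          = ≡.refl
sign-suc (suc zero)    = ≡.refl
sign-suc (suc (suc k)) = sign-suc k

mutual
  μ-unfold : ∀ n → μ n ≡ (if isSquarefree n then sign (ω n) else + 0)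
  μ-unfold n with isSquarefree n | ω n
  ... | true  | k = μ-sign n k
  ... | false | _ = ≡.refl

  -- The left-hand side is the sign function local to μ in Defs, which cannot be
  -- named here; Agda infers it from the use in μ-unfold.
  μ-sign : ∀ n k → _ ≡ sign k
  μ-sign n zero          = ≡.refl
  μ-sign n (suc zero)    = ≡.refl
  μ-sign n (suc (suc k)) = μ-sign n k

HasSquareFactor : ℕ → Set
HasSquareFactor n = ∃ λ d → 2 ≤ d × d * d ∣ n

squareTest : ℕ → Bool
squareTest n = any (λ d → ⌊ (d * d) ∣? n ⌋) (map suc (range1 n))

squareTest-sound : ∀ n → T (squareTest n) → HasSquareFactor n
squareTest-sound n t with find (any⁻ _ (map suc (range1 n)) t)
... | d , d∈ , dd∣n with ∈-map⁻ suc d∈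
... | _ , i∈ , ≡.refl with ∈-map⁻ suc i∈
... | _ , _ , ≡.refl = _ , s≤s (s≤s z≤n) , toWitness dd∣n

squareTest-complete : ∀ {n} → 1 ≤ n → HasSquareFactor n → T (squareTest n)
squareTest-complete {n} 1≤n (suc (suc i) , s≤s (s≤s z≤n) , dd∣n) =
  any⁺ _ (lose (∈-map⁺ suc (∈-map⁺ suc (∈-upTo⁺ i<n))) (fromWitness dd∣n))
  where
  i<n : i < n
  i<n = <-≤-trans (m<n⇒m<1+n (n<1+n i)) (≤-trans (m≤m*n (suc (suc i)) (suc (suc i))) (∣⇒≤ {{>-nonZero 1≤n}} dd∣n))

T-injective : ∀ {x y} → (T x → T y) → (T y → T x) → x ≡ y
T-injective {false} {false} _ _ = ≡.refl
T-injective {false} {true}  _ g = ⊥-elim (g _)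
T-injective {true}  {false} f _ = ⊥-elim (f _)
T-injective {true}  {true}  _ _ = ≡.refl

isSquarefree-false : ∀ {n} → 1 ≤ n → HasSquareFactor n → isSquarefree n ≡ false
isSquarefree-false {n} 1≤n sq = ≡.cong not (Equivalence.to T-≡ (squareTest-complete 1≤n sq))

isSquarefree-cong : ∀ {m n} → 1 ≤ m → 1 ≤ n →
                    (HasSquareFactor m → HasSquareFactor n) → (HasSquareFactor n → HasSquareFactor m) →
                    isSquarefree m ≡ isSquarefree n
isSquarefree-cong {m} {n} 1≤m 1≤n to from = ≡.cong not (T-injective
  (λ t → squareTest-complete 1≤n (to (squareTest-sound m t)))
  (λ t → squareTest-complete 1≤m (from (squareTest-sound n t))))

prime≥2 : ∀ {p} → Prime p → 2 ≤ p
prime≥2 {suc (suc _)} _ = s≤s (s≤s z≤n)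

prime∣prime⇒≡ : ∀ {p q} → Prime p → Prime q → p ∣ q → p ≡ q
prime∣prime⇒≡ pp pq p∣q with prime⇒irreducible pq p∣q
... | inj₁ ≡.refl = ⊥-elim (¬prime[1] pp)
... | inj₂ p≡q    = p≡q

prime∤⇒coprime : ∀ {p d} → Prime p → ¬ p ∣ d → Coprime p d
prime∤⇒coprime pp p∤d (g∣p , g∣d) with prime⇒irreducible pp g∣p
... | inj₁ g≡1     = g≡1
... | inj₂ ≡.refl = ⊥-elim (p∤d g∣d)

∃prime∣ : ∀ m → 2 ≤ m → ∃ λ p → Prime p × p ∣ m
∃prime∣ m@(suc (suc _)) (s≤s (s≤s z≤n)) with factorise m
... | record { factors = [] ; isFactorisation = () }
... | record { factors = p ∷ ps ; isFactorisation = eq ; factorsPrime = pp ∷ _ } =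
  p , pp , ≡.subst (p ∣_) (≡.sym eq) (m∣m*n (product ps))

hasSquareFactor-p*-∣ : ∀ {p m} → Prime p → p ∣ m → HasSquareFactor (p * m)
hasSquareFactor-p*-∣ {p} pp p∣m = p , prime≥2 pp , *-monoʳ-∣ p p∣m

hasSquareFactor-p*-∤ : ∀ {p m} → Prime p → ¬ p ∣ m → HasSquareFactor (p * m) → HasSquareFactor m
hasSquareFactor-p*-∤ {p} pp p∤m (d , 2≤d , dd∣pm) with p ∣? d
... | yes p∣d = ⊥-elim (p∤m (*-cancelˡ-∣ p {{prime⇒nonZero pp}} (∣-trans (*-pres-∣ p∣d p∣d) dd∣pm)))
... | no  p∤d = d , 2≤d , coprime-divisor (Coprimality.sym p⊥dd) dd∣pm
  where
  p⊥dd : Coprime p (d * d)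
  p⊥dd = prime∤⇒coprime pp (λ p∣dd → [ p∤d , p∤d ]′ (euclidsLemma d d pp p∣dd))

isSquarefree-p*-∣ : ∀ {p m} → Prime p → p ∣ m → 1 ≤ m → isSquarefree (p * m) ≡ false
isSquarefree-p*-∣ {p} pp p∣m 1≤m =
  isSquarefree-false (*-mono-≤ (≤-trans (s≤s z≤n) (prime≥2 pp)) 1≤m) (hasSquareFactor-p*-∣ pp p∣m)

isSquarefree-p*-∤ : ∀ {p m} → Prime p → ¬ p ∣ m → 1 ≤ m → isSquarefree (p * m) ≡ isSquarefree m
isSquarefree-p*-∤ {p} pp p∤m 1≤m = isSquarefree-cong (*-mono-≤ (≤-trans (s≤s z≤n) (prime≥2 pp)) 1≤m) 1≤m
  (hasSquareFactor-p*-∤ pp p∤m)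
  (λ { (d , 2≤d , dd∣m) → d , 2≤d , ∣n⇒∣m*n p dd∣m })

module ℕSum = FiniteSums +-0-commutativeMonoid

length-as-sum : ∀ {a} {A : Set a} (xs : List A) → length xs ≡ ℕSum.sumList (map (λ _ → 1) xs)
length-as-sum []       = ≡.refl
length-as-sum (_ ∷ xs) = ≡.cong suc (length-as-sum xs)

ω-as-sum : ∀ n → ω n ≡ ℕSum.sumDivisors n (λ x → ℕSum.when (prime? x) 1)
ω-as-sum n = ≡.trans (length-as-sum (filter prime? (filter (_∣? n) (range1 n))))
  (≡.trans (ℕSum.sumList-filter prime? _ (filter (_∣? n) (range1 n)))
           (ℕSum.sumList-filter (_∣? n) _ (range1 n)))

primeDivisors-p*-∤ : ∀ {p m} → Prime p → ¬ p ∣ m → ∀ x →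
  ℕSum.when (x ∣? p * m) (ℕSum.when (prime? x) 1) ≡ ℕSum.when (x ∣? m) (ℕSum.when (prime? x) 1) + ℕSum.when (x ≟ p) 1
primeDivisors-p*-∤ {p} {m} pp p∤m x with x ≟ p
... | yes ≡.refl = ≡.trans (ℕSum.when-yes (x ∣? p * m) (m∣m*n m))
                  (≡.trans (ℕSum.when-yes (prime? x) pp) (≡.cong (_+ 1) (≡.sym (ℕSum.when-no (x ∣? m) p∤m))))
... | no x≢p with prime? x
...   | no _  = ≡.trans (ℕSum.when-ε (x ∣? p * m)) (≡.sym (≡.cong (_+ 0) (ℕSum.when-ε (x ∣? m))))
...   | yes px = ≡.trans (ℕSum.when-⇔ (x ∣? p * m) (x ∣? m) x∣p*m⇒x∣m (∣n⇒∣m*n p)) (≡.sym (+-identityʳ _))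
  where
  x∣p*m⇒x∣m : x ∣ p * m → x ∣ m
  x∣p*m⇒x∣m x∣pm = [ (λ x∣p → ⊥-elim (x≢p (prime∣prime⇒≡ px pp x∣p))) , id ]′ (euclidsLemma p m px x∣pm)

ω-p*-∤ : ∀ {p m} → Prime p → ¬ p ∣ m → 1 ≤ m → ω (p * m) ≡ suc (ω m)
ω-p*-∤ {p} {m} pp p∤m 1≤m = begin
  ω (p * m)                                                   ≡⟨ ω-as-sum (p * m) ⟩
  sumTo (p * m) (λ x → when (x ∣? p * m) (P x))               ≡⟨ sumTo-cong (p * m) (λ x _ _ → primeDivisors-p*-∤ pp p∤m x) ⟩
  sumTo (p * m) (λ x → when (x ∣? m) (P x) + when (x ≟ p) 1)  ≡⟨ sumTo-∙ (p * m) _ _ ⟩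
  sumTo (p * m) (λ x → when (x ∣? m) (P x)) + sumTo (p * m) (λ x → when (x ≟ p) 1)
    ≡⟨ ≡.cong₂ _+_ (sumTo-divisors P 1≤m (m≤n*m m p {{prime⇒nonZero pp}})) count-p ⟩
  sumDivisors m P + 1                                         ≡⟨ +-comm _ 1 ⟩
  suc (sumDivisors m P)                                       ≡⟨ ≡.cong suc (ω-as-sum m) ⟨
  suc (ω m)                                                   ∎
  where
  open ℕSum
  open ≡.≡-Reasoning
  P : ℕ → ℕ
  P x = when (prime? x) 1
  count-p : sumTo (p * m) (λ x → when (x ≟ p) 1) ≡ 1
  count-p = ≡.trans (sumTo-single p _ (≤-trans (s≤s z≤n) (prime≥2 pp)) (m≤m*n p m {{>-nonZero 1≤m}})
                                   (λ i _ _ i≢p → when-no (i ≟ p) i≢p))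
                    (when-yes (p ≟ p) ≡.refl)

μ-p*-∣ : ∀ {p m} → Prime p → p ∣ m → 1 ≤ m → μ (p * m) ≡ + 0
μ-p*-∣ {p} {m} pp p∣m 1≤m rewrite μ-unfold (p * m) | isSquarefree-p*-∣ pp p∣m 1≤m = ≡.refl

μ-p*-∤ : ∀ {p m} → Prime p → ¬ p ∣ m → 1 ≤ m → μ (p * m) ≡ ℤ.- μ m
μ-p*-∤ {p} {m} pp p∤m 1≤m
  rewrite μ-unfold (p * m) | μ-unfold m | isSquarefree-p*-∤ pp p∤m 1≤m | ω-p*-∤ pp p∤m 1≤m
  with isSquarefree m
... | true  = sign-suc (ω m)
... | false = ≡.refl

-- Solutions of a ≡ 0 (mod d), a ≡ 1 (mod e)

Residue01 : ℕ → ℕ → ℕ → Set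
Residue01 d e a = d ∣ a × e ∣ a ∸ 1

residue01? : ∀ d e a → Dec (Residue01 d e a)
residue01? d e a = d ∣? a ×-dec e ∣? a ∸ 1

-- 1 ≤ a excludes a = 0, where truncated subtraction makes e ∣ a ∸ 1 hold trivially.
residue01⇒gcd≡1 : ∀ {d e a} → 1 ≤ a → Residue01 d e a → gcd d e ≡ 1
residue01⇒gcd≡1 {d} {e} {suc a} _ (d∣1+a , e∣a) =
  ∣1⇒≡1 (∣m+n∣m⇒∣n (≡.subst (gcd d e ∣_) (+-comm 1 a) (∣-trans (gcd[m,n]∣m d e) d∣1+a))
                   (∣-trans (gcd[m,n]∣n d e) e∣a))

coprime⇒*∣ : ∀ {d e x} → Coprime d e → d ∣ x → e ∣ x → d * e ∣ x
coprime⇒*∣ {d} {e} d⊥e (divides q ≡.refl) e∣qd with coprime-divisor (Coprimality.sym d⊥e) (≡.subst (e ∣_) (*-comm q d) e∣qd)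
... | divides r ≡.refl = divides r (solve 3 (λ r e d → (r :* e) :* d := r :* (d :* e)) ≡.refl r e d)

residue01-exists : ∀ {d e} → 1 ≤ d → 1 ≤ e → Coprime d e → ∃ λ a → 1 ≤ a × Residue01 d e a
residue01-exists {d} {e} 1≤d 1≤e d⊥e with coprime-Bézout d⊥e
... | Bézout.+- x y 1+ye≡xd = x * d , ≡.subst (1 ≤_) 1+ye≡xd (s≤s z≤n) , n∣m*n x
                            , ≡.subst (λ t → e ∣ t ∸ 1) 1+ye≡xd (n∣m*n y)
-- Here y * e ≡ 1 (mod d), so a = 1 + y * e * (d * e - 1) ≡ 1 - 1 (mod d) and a ≡ 1 (mod e).
... | Bézout.-+ x y 1+xd≡ye = suc (y * e * k) , s≤s z≤n , divides (e + x * k) d∣a , n∣m*n*o y k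
  where
  open ≡.≡-Reasoning
  k = pred (d * e)
  d∣a : suc (y * e * k) ≡ (e + x * k) * d
  d∣a = begin
    suc (y * e * k)       ≡⟨ ≡.cong (λ t → suc (t * k)) 1+xd≡ye ⟨
    suc k + x * d * k     ≡⟨ ≡.cong (_+ x * d * k) (suc-pred (d * e) {{>-nonZero (*-mono-≤ 1≤d 1≤e)}}) ⟩
    d * e + x * d * k     ≡⟨ solve 4 (λ d e x k → d :* e :+ x :* d :* k := (e :+ x :* k) :* d) ≡.refl d e x k ⟩
    (e + x * k) * d       ∎

residue01-+⇔ : ∀ {d e j} L → d ∣ L → e ∣ L → 1 ≤ j → Residue01 d e (L + j) ⇔ Residue01 d e j
residue01-+⇔ {e = e} {j = suc j} L d∣L e∣L _ = mk⇔
  (λ (d∣L+j , e∣L+j) → ∣m+n∣m⇒∣n d∣L+j d∣L , ∣m+n∣m⇒∣n (≡.subst (e ∣_) L+[1+j]∸1≡L+j e∣L+j) e∣L)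
  (λ (d∣j , e∣j) → ∣m∣n⇒∣m+n d∣L d∣j , ≡.subst (e ∣_) (≡.sym L+[1+j]∸1≡L+j) (∣m∣n⇒∣m+n e∣L e∣j))
  where
  L+[1+j]∸1≡L+j : L + suc j ∸ 1 ≡ L + j
  L+[1+j]∸1≡L+j = ≡.cong (_∸ 1) (+-suc L j)

module CoprimeResidue01 {d e : ℕ} (1≤d : 1 ≤ d) (1≤e : 1 ≤ e) (d⊥e : Coprime d e) where

  L : ℕ
  L = d * e

  1≤L : 1 ≤ L
  1≤L = *-mono-≤ 1≤d 1≤e

  instance
    L≢0 : NonZero L
    L≢0 = >-nonZero 1≤L

  residue01-periodic : ∀ {j} → 1 ≤ j → Residue01 d e (L + j) ⇔ Residue01 d e j
  residue01-periodic = residue01-+⇔ L (m∣m*n e) (n∣m*n d)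

  residue01-reduce : ∀ q {j} → 1 ≤ j → Residue01 d e (q * L + j) → Residue01 d e j
  residue01-reduce zero    1≤j r = r
  residue01-reduce (suc q) {j} 1≤j r = residue01-reduce q 1≤j
    (Equivalence.to (residue01-periodic (≤-trans 1≤j (m≤n+m j (q * L)))) (≡.subst (Residue01 d e) (+-assoc L (q * L) j) r))

  residue01-inPeriod : ∃ λ a → 1 ≤ a × a ≤ L × Residue01 d e a
  residue01-inPeriod with residue01-exists 1≤d 1≤e d⊥e
  ... | a , 1≤a , r with a % L | m≡m%n+[m/n]*n a L | m%n<n a L
  ...   | suc i | a≡ | i<L = suc i , s≤s z≤n , <⇒≤ i<L ,
          residue01-reduce (a / L) (s≤s z≤n) (≡.subst (Residue01 d e) (≡.trans a≡ (+-comm (suc i) _)) r)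
  ...   | zero  | a≡ | _ with a / L
  ...     | zero  = ⊥-elim (<⇒≱ 1≤a (≡.subst (_≤ 0) (≡.sym a≡) z≤n))
  ...     | suc q = L , 1≤L , ≤-refl , residue01-reduce q 1≤L (≡.subst (Residue01 d e) (≡.trans a≡ (+-comm L (q * L))) r)

  -- Two solutions in one period differ by a multiple of L smaller than L.
  residue01-unique≤ : ∀ {a b} → 1 ≤ a → a ≤ b → b ≤ L → Residue01 d e a → Residue01 d e b → a ≡ b
  residue01-unique≤ {a} 1≤a a≤b b≤L (d∣a , e∣a-1) (d∣b , e∣b-1) with m≤n⇒∃[o]m+o≡n a≤b
  ... | zero  , ≡.refl = ≡.sym (+-identityʳ a)
  ... | suc δ , ≡.refl = ⊥-elim (<⇒≱ (≤-trans (+-monoˡ-≤ (suc δ) 1≤a) b≤L) (∣⇒≤ L∣δ))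
    where
    L∣δ : L ∣ suc δ
    L∣δ = coprime⇒*∣ d⊥e (∣m+n∣m⇒∣n d∣b d∣a)
                         (∣m+n∣m⇒∣n (≡.subst (e ∣_) (+-∸-comm (suc δ) 1≤a) e∣b-1) e∣a-1)

  residue01-unique : ∀ {a b} → 1 ≤ a → 1 ≤ b → a ≤ L → b ≤ L → Residue01 d e a → Residue01 d e b → a ≡ b
  residue01-unique 1≤a 1≤b a≤L b≤L ra rb with ≤-total _ _
  ... | inj₁ a≤b = residue01-unique≤ 1≤a a≤b b≤L ra rb
  ... | inj₂ b≤a = ≡.sym (residue01-unique≤ 1≤b b≤a a≤L rb ra)

gcd≥1 : ∀ a {n} → 1 ≤ n → 1 ≤ gcd a n
gcd≥1 a 1≤n = n≢0⇒n>0 (λ g≡0 → <⇒≱ 1≤n (≤-reflexive (gcd[m,n]≡0⇒n≡0 a g≡0)))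

module ArithmeticFunctions {c ℓ} (R : CommutativeRing c ℓ) where
  open CommutativeRing R renaming
    ( Carrier to C; _+_ to _⊕_; _*_ to _⊗_; +-cong to ⊕-cong; +-congˡ to ⊕-congˡ; +-congʳ to ⊕-congʳ
    ; *-comm to ⊗-comm; *-cong to ⊗-cong; *-congˡ to ⊗-congˡ; *-congʳ to ⊗-congʳ
    ; *-identityˡ to ⊗-identityˡ; *-identityʳ to ⊗-identityʳ
    ; +-identityʳ to ⊕-identityʳ )
  open import Algebra.Properties.Ring ring using (-0#≈0#; -‿involutive; -‿+-comm)
  open import Relation.Binary.Reasoning.Setoid setoid
  open Arith R
  open FiniteSums +-commutativeMonoid

  when-*ʳ : ∀ {p} {A : Set p} (a? : Dec A) x y → when a? x ⊗ y ≈ when a? (x ⊗ y)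
  when-*ʳ (yes _) x y = refl
  when-*ʳ (no _)  x y = zeroˡ y

  when-*ˡ : ∀ {p} {A : Set p} (a? : Dec A) x y → y ⊗ when a? x ≈ when a? (y ⊗ x)
  when-*ˡ (yes _) x y = refl
  when-*ˡ (no _)  x y = zeroʳ y

  when-1⊗ : ∀ {p} {A : Set p} (a? : Dec A) x → when a? 1# ⊗ x ≈ when a? x
  when-1⊗ a? x = trans (when-*ʳ a? 1# x) (when-cong a? (λ _ → ⊗-identityˡ x))

  when-interchange : ∀ {p q r s} {A : Set p} {B : Set q} {D : Set r} {E : Set s}
                     (a? : Dec A) (b? : Dec B) (d? : Dec D) (e? : Dec E) x y →
    when a? (when b? x) ⊗ when d? (when e? y) ≈ when a? (when d? (x ⊗ y)) ⊗ when (b? ×-dec e?) 1#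
  when-interchange (no _)  b?      d?      e?      x y = trans (zeroˡ _) (sym (zeroˡ _))
  when-interchange (yes _) (no _)  d?      e?      x y = trans (zeroˡ _) (sym (zeroʳ _))
  when-interchange (yes _) (yes _) (no _)  e?      x y = trans (zeroʳ _) (sym (zeroˡ _))
  when-interchange (yes _) (yes _) (yes _) (no _)  x y = trans (zeroʳ _) (sym (zeroʳ _))
  when-interchange (yes _) (yes _) (yes _) (yes _) x y = sym (⊗-identityʳ _)

  sumTo-*ˡ : ∀ n a (F : ℕ → C) → sumTo n (λ i → a ⊗ F i) ≈ a ⊗ sumTo n F
  sumTo-*ˡ zero    a F = sym (zeroʳ a)
  sumTo-*ˡ (suc n) a F = begin
    sumTo (suc n) (λ i → a ⊗ F i)           ≈⟨ sumTo-suc n _ ⟩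
    sumTo n (λ i → a ⊗ F i) ⊕ a ⊗ F (suc n) ≈⟨ ⊕-congʳ (sumTo-*ˡ n a F) ⟩
    a ⊗ sumTo n F ⊕ a ⊗ F (suc n)           ≈⟨ distribˡ a _ _ ⟨
    a ⊗ (sumTo n F ⊕ F (suc n))             ≈⟨ ⊗-congˡ (sumTo-suc n F) ⟨
    a ⊗ sumTo (suc n) F                     ∎

  sumTo-*ʳ : ∀ n a (F : ℕ → C) → sumTo n (λ i → F i ⊗ a) ≈ sumTo n F ⊗ a
  sumTo-*ʳ n a F = trans (sumTo-cong n (λ i _ _ → ⊗-comm (F i) a)) (trans (sumTo-*ˡ n a F) (⊗-comm a _))

  sumTo-*-sumTo : ∀ n m (F G : ℕ → C) → sumTo n F ⊗ sumTo m G ≈ sumTo n (λ i → sumTo m (λ j → F i ⊗ G j))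
  sumTo-*-sumTo n m F G = sym (trans (sumTo-cong n (λ i _ _ → sumTo-*ˡ m (F i) G)) (sumTo-*ʳ n _ F))

  sumTo-neg : ∀ n (F : ℕ → C) → sumTo n (λ i → - F i) ≈ - sumTo n F
  sumTo-neg zero    F = sym -0#≈0#
  sumTo-neg (suc n) F = begin
    sumTo (suc n) (λ i → - F i)         ≈⟨ sumTo-suc n _ ⟩
    sumTo n (λ i → - F i) ⊕ - F (suc n) ≈⟨ ⊕-congʳ (sumTo-neg n F) ⟩
    - sumTo n F ⊕ - F (suc n)           ≈⟨ -‿+-comm _ _ ⟩
    - (sumTo n F ⊕ F (suc n))           ≈⟨ -‿cong (sumTo-suc n F) ⟨
    - sumTo (suc n) F                   ∎

  fromℤ-neg : ∀ z → fromℤ (ℤ.- z) ≈ - fromℤ z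
  fromℤ-neg (+ zero)  = sym -0#≈0#
  fromℤ-neg (+ suc n) = refl
  fromℤ-neg -[1+ n ]  = sym (-‿involutive _)

  μA-p*-∣ : ∀ {p m} → Prime p → p ∣ m → 1 ≤ m → μA (p * m) ≈ 0#
  μA-p*-∣ pp p∣m 1≤m = reflexive (≡.cong fromℤ (μ-p*-∣ pp p∣m 1≤m))

  μA-p*-∤ : ∀ {p m} → Prime p → ¬ p ∣ m → 1 ≤ m → μA (p * m) ≈ - μA m
  μA-p*-∤ {m = m} pp p∤m 1≤m = trans (reflexive (≡.cong fromℤ (μ-p*-∤ pp p∤m 1≤m))) (fromℤ-neg (μ m))

  sumTo-multiples : ∀ {p} k (F : ℕ → C) → 1 ≤ p → sumTo (p * k) (λ d → when (p ∣? d) (F d)) ≈ sumTo k (λ j → F (p * j))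
  sumTo-multiples {p} zero    F 1≤p = reflexive (≡.cong (λ t → sumTo t (λ d → when (p ∣? d) (F d))) (ℕₚ.*-zeroʳ p))
  sumTo-multiples {p} (suc k) F 1≤p = begin
    sumTo (p * suc k) G                            ≡⟨ ≡.cong (λ t → sumTo t G) p*[1+k]≡p*k+p ⟩
    sumTo (p * k + p) G                            ≈⟨ sumTo-+ (p * k) p G ⟩
    sumTo (p * k) G ⊕ sumTo p (λ j → G (p * k + j)) ≈⟨ ⊕-cong (sumTo-multiples k F 1≤p) lastBlock ⟩
    sumTo k (λ j → F (p * j)) ⊕ F (p * suc k)       ≈⟨ sumTo-suc k _ ⟨
    sumTo (suc k) (λ j → F (p * j))                ∎
    where
    G : ℕ → C
    G d = when (p ∣? d) (F d)
    p*[1+k]≡p*k+p : p * suc k ≡ p * k + p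
    p*[1+k]≡p*k+p = ≡.trans (ℕₚ.*-suc p k) (ℕₚ.+-comm p (p * k))
    lastBlock : sumTo p (λ j → G (p * k + j)) ≈ F (p * suc k)
    lastBlock = trans (sumTo-single p _ 1≤p ≤-refl p∤) (trans (when-yes (p ∣? p * k + p) (∣m∣n⇒∣m+n (m∣m*n k) ∣-refl))
                                                             (reflexive (≡.cong F (≡.sym p*[1+k]≡p*k+p))))
      where
      p∤ : ∀ j → 1 ≤ j → j ≤ p → j ≢ p → G (p * k + j) ≈ 0#
      p∤ j 1≤j j≤p j≢p = when-no (p ∣? p * k + j)
        (λ p∣ → <⇒≱ (≤∧≢⇒< j≤p j≢p) (∣⇒≤ {{>-nonZero 1≤j}} (∣m+n∣m⇒∣n p∣ (m∣m*n k))))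

  -- The multiples d = p j of p contribute μ (p j) = - μ j when p ∤ j and 0 otherwise,
  -- so they cancel the divisors prime to p.
  sumDivisors-μ-p* : ∀ {p m} → Prime p → 1 ≤ m → sumDivisors (p * m) μA ≈ 0#
  sumDivisors-μ-p* {p} {m} pp 1≤m = begin
    sumTo n G                                                  ≈⟨ sumTo-cong n (λ d _ _ → when-split (p ∣? d) (G d)) ⟩
    sumTo n (λ d → when (p ∣? d) (G d) ⊕ when (¬? (p ∣? d)) (G d)) ≈⟨ sumTo-∙ n _ _ ⟩
    sumTo n (λ d → when (p ∣? d) (G d)) ⊕ sumTo n (λ d → when (¬? (p ∣? d)) (G d))
                                                               ≈⟨ ⊕-cong multiples nonMultiples ⟩
    - H ⊕ H                                                    ≈⟨ -‿inverseˡ H ⟩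
    0#                                                         ∎
    where
    n = p * m
    G : ℕ → C
    G d = when (d ∣? n) (μA d)
    H′ : ℕ → C
    H′ j = when (¬? (p ∣? j)) (μA j)
    H : C
    H = sumDivisors m H′

    atMultiple : ∀ j → 1 ≤ j → G (p * j) ≈ - when (j ∣? m) (H′ j)
    atMultiple j 1≤j with p * j ∣? n | j ∣? m | p ∣? j
    ... | yes _    | yes _   | yes p∣j = trans (μA-p*-∣ pp p∣j 1≤j) (sym -0#≈0#)
    ... | yes _    | yes _   | no p∤j  = μA-p*-∤ pp p∤j 1≤j
    ... | yes pj∣n | no j∤m  | _       = ⊥-elim (j∤m (*-cancelˡ-∣ p {{prime⇒nonZero pp}} pj∣n))
    ... | no pj∤n  | yes j∣m | _       = ⊥-elim (pj∤n (*-monoʳ-∣ p j∣m))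
    ... | no _     | no _    | _       = sym -0#≈0#

    multiples : sumTo n (λ d → when (p ∣? d) (G d)) ≈ - H
    multiples = begin
      sumTo n (λ d → when (p ∣? d) (G d))   ≈⟨ sumTo-multiples m G (≤-trans (s≤s z≤n) (prime≥2 pp)) ⟩
      sumTo m (λ j → G (p * j))             ≈⟨ sumTo-cong m (λ j 1≤j _ → atMultiple j 1≤j) ⟩
      sumTo m (λ j → - when (j ∣? m) (H′ j)) ≈⟨ sumTo-neg m _ ⟩
      - H                                   ∎

    atNonMultiple : ∀ d → when (¬? (p ∣? d)) (G d) ≈ when (d ∣? m) (H′ d)
    atNonMultiple d with p ∣? d
    ... | yes _   = sym (when-ε (d ∣? m))
    ... | no  p∤d = when-⇔ (d ∣? n) (d ∣? m) (coprime-divisor (Coprimality.sym (prime∤⇒coprime pp p∤d))) (∣n⇒∣m*n p)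

    nonMultiples : sumTo n (λ d → when (¬? (p ∣? d)) (G d)) ≈ H
    nonMultiples = trans (sumTo-cong n (λ d _ _ → atNonMultiple d)) (sumTo-divisors H′ 1≤m (m≤n*m m p {{prime⇒nonZero pp}}))

  sumDivisors-μ : ∀ {m} → 1 ≤ m → sumDivisors m μA ≈ when (m ≟ 1) 1#
  sumDivisors-μ {suc zero} _ = trans (⊕-identityʳ _) (⊕-identityʳ _)
  sumDivisors-μ {m@(suc (suc _))} _ with ∃prime∣ m (s≤s (s≤s z≤n))
  ... | p , pp , divides (suc q) m≡q*p =
    trans (reflexive (≡.cong (λ t → sumDivisors t μA) (≡.trans m≡q*p (ℕₚ.*-comm (suc q) p))))
          (sumDivisors-μ-p* pp (s≤s z≤n))

  factorPairs-sum : ∀ n (h : ℕ × ℕ → C) →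
    Σ (map h (factorPairs n)) ≈ sumTo n (λ d → sumTo n (λ e → when (d * e ≟ n) (h (d , e))))
  factorPairs-sum n h = begin
    Σ (map h (factorPairs n))
      ≈⟨ sumList-filter (λ (d , e) → d * e ≟ n) h (concatMap pairsWith (range1 n)) ⟩
    sumList (map h′ (concatMap pairsWith (range1 n)))
      ≈⟨ sumList-concatMap pairsWith h′ (range1 n) ⟩
    sumList (map (λ d → sumList (map h′ (pairsWith d))) (range1 n))
      ≡⟨ ≡.cong sumList (map-cong (λ d → ≡.cong sumList (≡.sym (map-∘ (range1 n)))) (range1 n)) ⟩
    sumTo n (λ d → sumTo n (λ e → h′ (d , e)))
      ∎
    where
    pairsWith : ℕ → List (ℕ × ℕ)
    pairsWith d = map (d ,_) (range1 n)
    h′ : ℕ × ℕ → C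
    h′ (d , e) = when (d * e ≟ n) (h (d , e))

  ⋆-sumTo : ∀ (G H : ArithFun) n → (G ⋆ H) n ≈ sumTo n (λ d → sumTo n (λ e → when (d * e ≟ n) (G d ⊗ H e)))
  ⋆-sumTo G H n = factorPairs-sum n (λ (d , e) → G d ⊗ H e)

  ⊠-sumTo : ∀ (G H : ArithFun) n →
    (G ⊠ H) n ≈ sumTo n (λ d → sumTo n (λ e → when (d * e ≟ n) (when (gcd d e ≟ 1) (G d ⊗ H e))))
  ⊠-sumTo G H n = trans (sumList-filter (λ (d , e) → gcd d e ≟ 1) (λ (d , e) → G d ⊗ H e) (factorPairs n))
                        (factorPairs-sum n (λ (d , e) → when (gcd d e ≟ 1) (G d ⊗ H e)))

  M-sumTo : ∀ (f : ArithFun) n → M f n ≈ sumTo n (λ a → when (gcd a n ≟ 1) (f (gcd (a ∸ 1) n)))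
  M-sumTo f n = sumList-filter (λ a → gcd a n ≟ 1) (λ a → f (gcd (a ∸ 1) n)) (range1 n)

  factorPairSum-extend : ∀ {y n} (K : ℕ → ℕ → C) → y ≤ n →
    sumTo y (λ d → sumTo y (λ e → when (d * e ≟ y) (K d e))) ≈ sumTo n (λ d → sumTo n (λ e → when (d * e ≟ y) (K d e)))
  factorPairSum-extend {y} {n} K y≤n = sym (begin
    sumTo n (λ d → sumTo n (λ e → term d e))
      ≈⟨ sumTo-extend _ y≤n (λ d y<d _ → sumTo-ε n (λ e 1≤e _ → term-left y<d 1≤e)) ⟩
    sumTo y (λ d → sumTo n (λ e → term d e))
      ≈⟨ sumTo-cong y (λ d 1≤d _ → sumTo-extend _ y≤n (λ e y<e _ → term-right 1≤d y<e)) ⟩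
    sumTo y (λ d → sumTo y (λ e → term d e)) ∎)
    where
    term : ℕ → ℕ → C
    term d e = when (d * e ≟ y) (K d e)
    term-left : ∀ {d e} → y < d → 1 ≤ e → term d e ≈ 0#
    term-left {d} {e} y<d 1≤e = when-no (d * e ≟ y)
      (λ de≡y → <⇒≱ y<d (≡.subst (d ≤_) de≡y (m≤m*n d e {{>-nonZero 1≤e}})))
    term-right : ∀ {d e} → 1 ≤ d → y < e → term d e ≈ 0#
    term-right {d} {e} 1≤d y<e = when-no (d * e ≟ y)
      (λ de≡y → <⇒≱ y<e (≡.subst (e ≤_) de≡y (m≤n*m e d {{>-nonZero 1≤d}})))

  sumTo-μ-*∣ : ∀ {k t} → 1 ≤ k → 1 ≤ t → sumTo k (λ s → when (s * t ∣? k) (μA s)) ≈ when (k ≟ t) 1#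
  sumTo-μ-*∣ {k} {t} 1≤k 1≤t with t ∣? k
  ... | no t∤k = trans (sumTo-ε k (λ s _ _ → when-no (s * t ∣? k) (λ st∣k → t∤k (m*n∣⇒n∣ s t st∣k))))
                       (sym (when-no (k ≟ t) (λ k≡t → t∤k (≡.subst (t ∣_) (≡.sym k≡t) ∣-refl))))
  ... | yes (divides q k≡q*t) = begin
    sumTo k (λ s → when (s * t ∣? k) (μA s)) ≈⟨ sumTo-cong k (λ s _ _ → when-⇔ (s * t ∣? k) (s ∣? q) to from) ⟩
    sumTo k (λ s → when (s ∣? q) (μA s))     ≈⟨ sumTo-divisors μA 1≤q q≤k ⟩
    sumDivisors q μA                         ≈⟨ sumDivisors-μ 1≤q ⟩
    when (q ≟ 1) 1#                          ≈⟨ when-⇔ (q ≟ 1) (k ≟ t) q≡1⇒k≡t k≡t⇒q≡1 ⟩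
    when (k ≟ t) 1#                          ∎
    where
    instance
      t≢0 : NonZero t
      t≢0 = >-nonZero 1≤t
    to : ∀ {s} → s * t ∣ k → s ∣ q
    to {s} st∣k = *-cancelʳ-∣ t (≡.subst (s * t ∣_) k≡q*t st∣k)
    from : ∀ {s} → s ∣ q → s * t ∣ k
    from {s} s∣q = ≡.subst (s * t ∣_) (≡.sym k≡q*t) (*-monoˡ-∣ t s∣q)
    1≤q : 1 ≤ q
    1≤q = n≢0⇒n>0 (λ q≡0 → <⇒≱ 1≤k (≤-reflexive (≡.trans k≡q*t (≡.cong (_* t) q≡0))))
    q≤k : q ≤ k
    q≤k = ≡.subst (q ≤_) (≡.sym k≡q*t) (m≤m*n q t)
    q≡1⇒k≡t : q ≡ 1 → k ≡ t
    q≡1⇒k≡t ≡.refl = ≡.trans k≡q*t (*-identityˡ t)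
    k≡t⇒q≡1 : k ≡ t → q ≡ 1
    k≡t⇒q≡1 k≡t = *-cancelʳ-≡ q 1 t (≡.trans (≡.sym k≡q*t) (≡.trans k≡t (≡.sym (*-identityˡ t))))

  sumDivisors-μ⋆ : ∀ (f : ArithFun) {k} → 1 ≤ k → sumDivisors k (μA ⋆ f) ≈ f k
  sumDivisors-μ⋆ f {k} 1≤k = begin
    sumTo k (λ e → when (e ∣? k) ((μA ⋆ f) e))
      ≈⟨ sumTo-cong k (λ e _ e≤k → when-cong (e ∣? k) (λ _ →
           trans (⋆-sumTo μA f e) (factorPairSum-extend (λ s t → μA s ⊗ f t) e≤k))) ⟩
    sumTo k (λ e → when (e ∣? k) (sumTo k (λ s → sumTo k (λ t → when (s * t ≟ e) (μA s ⊗ f t)))))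
      ≈⟨ sumTo-cong k (λ e _ _ → when-inside e) ⟩
    sumTo k (λ e → sumTo k (λ s → sumTo k (λ t → when (s * t ≟ e) (when (e ∣? k) (μA s ⊗ f t)))))
      ≈⟨ sumTo-rotate k _ ⟩
    sumTo k (λ s → sumTo k (λ t → sumTo k (λ e → when (s * t ≟ e) (when (e ∣? k) (μA s ⊗ f t)))))
      ≈⟨ sumTo-cong k (λ s 1≤s _ → sumTo-cong k (λ t 1≤t _ → sumTo-≟ _ (*-mono-≤ 1≤s 1≤t)
           (λ k<st → when-no (s * t ∣? k) (λ st∣k → <⇒≱ k<st (∣⇒≤ {{>-nonZero 1≤k}} st∣k))))) ⟩
    sumTo k (λ s → sumTo k (λ t → when (s * t ∣? k) (μA s ⊗ f t)))
      ≈⟨ sumTo-comm k k _ ⟩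
    sumTo k (λ t → sumTo k (λ s → when (s * t ∣? k) (μA s ⊗ f t)))
      ≈⟨ sumTo-cong k (λ t _ _ → trans (sumTo-cong k (λ s _ _ → sym (when-*ʳ (s * t ∣? k) (μA s) (f t))))
                                       (sumTo-*ʳ k (f t) _)) ⟩
    sumTo k (λ t → sumTo k (λ s → when (s * t ∣? k) (μA s)) ⊗ f t)
      ≈⟨ sumTo-cong k (λ t 1≤t _ → trans (⊗-congʳ (sumTo-μ-*∣ 1≤k 1≤t)) (when-1⊗ (k ≟ t) (f t))) ⟩
    sumTo k (λ t → when (k ≟ t) (f t))
      ≈⟨ sumTo-≟ f 1≤k (λ k<k → ⊥-elim (<-irrefl ≡.refl k<k)) ⟩
    f k ∎
    where
    when-inside : ∀ e → when (e ∣? k) (sumTo k (λ s → sumTo k (λ t → when (s * t ≟ e) (μA s ⊗ f t))))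
                      ≈ sumTo k (λ s → sumTo k (λ t → when (s * t ≟ e) (when (e ∣? k) (μA s ⊗ f t))))
    when-inside e = trans (when-sumTo (e ∣? k) k _) (sumTo-cong k (λ s _ _ →
      trans (when-sumTo (e ∣? k) k _) (sumTo-cong k (λ t _ _ → when-comm (e ∣? k) (s * t ≟ e) _))))

  sumDivisors-gcd : ∀ (F : ℕ → C) a {n} → 1 ≤ n →
    sumDivisors (gcd a n) F ≈ sumTo n (λ d → when (d ∣? n) (when (d ∣? a) (F d)))
  sumDivisors-gcd F a {n} 1≤n = trans (sym (sumTo-divisors F (gcd≥1 a 1≤n) (∣⇒≤ {{>-nonZero 1≤n}} (gcd[m,n]∣n a n))))
    (sumTo-cong n (λ d _ _ → when-× (d ∣? gcd a n) (d ∣? n) (d ∣? a)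
      (λ d∣g → ∣-trans d∣g (gcd[m,n]∣n a n) , ∣-trans d∣g (gcd[m,n]∣m a n)) (λ d∣n d∣a → gcd-greatest d∣a d∣n)))

  coprimality-as-μ-sum : ∀ a {n} → 1 ≤ n → when (gcd a n ≟ 1) 1# ≈ sumTo n (λ d → when (d ∣? n) (when (d ∣? a) (μA d)))
  coprimality-as-μ-sum a 1≤n = trans (sym (sumDivisors-μ (gcd≥1 a 1≤n))) (sumDivisors-gcd μA a 1≤n)

  gcd-as-μ⋆-sum : ∀ (f : ArithFun) b {n} → 1 ≤ n →
                  f (gcd b n) ≈ sumTo n (λ e → when (e ∣? n) (when (e ∣? b) ((μA ⋆ f) e)))
  gcd-as-μ⋆-sum f b 1≤n = trans (sym (sumDivisors-μ⋆ f (gcd≥1 b 1≤n))) (sumDivisors-gcd (μA ⋆ f) b 1≤n)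

  cofactor : ArithFun → ℕ → ℕ → C
  cofactor G n k = sumTo n (λ x → when (x * k ≟ n) (G x))

  cofactor-∣ : ∀ (G : ArithFun) {n k q} → 1 ≤ n → n ≡ q * k → cofactor G n k ≈ G q
  cofactor-∣ G {n} {k} {q} 1≤n n≡q*k = trans (sumTo-single q _ (>-nonZero⁻¹ q) q≤n others) (when-yes (q * k ≟ n) (≡.sym n≡q*k))
    where
    instance
      q*k≢0 : NonZero (q * k)
      q*k≢0 = >-nonZero (≡.subst (1 ≤_) n≡q*k 1≤n)
      q≢0 : NonZero q
      q≢0 = m*n≢0⇒m≢0 q
      k≢0 : NonZero k
      k≢0 = m*n≢0⇒n≢0 q
    q≤n : q ≤ n
    q≤n = ≡.subst (q ≤_) (≡.sym n≡q*k) (m≤m*n q k)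
    others : ∀ i → 1 ≤ i → i ≤ n → i ≢ q → when (i * k ≟ n) (G i) ≈ 0#
    others i _ _ i≢q = when-no (i * k ≟ n) (λ i*k≡n → i≢q (*-cancelʳ-≡ i q k (≡.trans i*k≡n n≡q*k)))

  cofactor-∤ : ∀ (G : ArithFun) {n k} → ¬ k ∣ n → cofactor G n k ≈ 0#
  cofactor-∤ G {n} {k} k∤n = sumTo-ε n (λ x _ _ → when-no (x * k ≟ n) (λ x*k≡n → k∤n (divides x (≡.sym x*k≡n))))

  ⋆-cofactor : ∀ (G H : ArithFun) n → (G ⋆ H) n ≈ sumTo n (λ y → H y ⊗ cofactor G n y)
  ⋆-cofactor G H n = begin
    (G ⋆ H) n                                                   ≈⟨ ⋆-sumTo G H n ⟩
    sumTo n (λ x → sumTo n (λ y → when (x * y ≟ n) (G x ⊗ H y))) ≈⟨ sumTo-comm n n _ ⟩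
    sumTo n (λ y → sumTo n (λ x → when (x * y ≟ n) (G x ⊗ H y))) ≈⟨ sumTo-cong n (λ y _ _ → pullOut y) ⟩
    sumTo n (λ y → H y ⊗ cofactor G n y)                         ∎
    where
    pullOut : ∀ y → sumTo n (λ x → when (x * y ≟ n) (G x ⊗ H y)) ≈ H y ⊗ cofactor G n y
    pullOut y = trans (sumTo-cong n (λ x _ _ → sym (when-*ʳ (x * y ≟ n) (G x) (H y))))
                      (trans (sumTo-*ʳ n (H y) _) (⊗-comm _ (H y)))

  factorPairSum-collapse : ∀ {n} (K : ℕ → ℕ → C) (Φ : ℕ → C) → (∀ y → n < y → Φ y ≈ 0#) →
    sumTo n (λ y → sumTo n (λ d → sumTo n (λ e → when (d * e ≟ y) (K d e))) ⊗ Φ y)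
      ≈ sumTo n (λ d → sumTo n (λ e → K d e ⊗ Φ (d * e)))
  factorPairSum-collapse {n} K Φ Φ≈0 = begin
    sumTo n (λ y → sumTo n (λ d → sumTo n (λ e → when (d * e ≟ y) (K d e))) ⊗ Φ y)
      ≈⟨ sumTo-cong n (λ y _ _ → distribute y) ⟩
    sumTo n (λ y → sumTo n (λ d → sumTo n (λ e → when (d * e ≟ y) (K d e ⊗ Φ y))))
      ≈⟨ sumTo-rotate n _ ⟩
    sumTo n (λ d → sumTo n (λ e → sumTo n (λ y → when (d * e ≟ y) (K d e ⊗ Φ y))))
      ≈⟨ sumTo-cong n (λ d 1≤d _ → sumTo-cong n (λ e 1≤e _ →
           sumTo-≟ _ (*-mono-≤ 1≤d 1≤e) (λ n<de → trans (⊗-congˡ (Φ≈0 (d * e) n<de)) (zeroʳ _)))) ⟩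
    sumTo n (λ d → sumTo n (λ e → K d e ⊗ Φ (d * e)))
      ∎
    where
    distribute : ∀ y → sumTo n (λ d → sumTo n (λ e → when (d * e ≟ y) (K d e))) ⊗ Φ y
                     ≈ sumTo n (λ d → sumTo n (λ e → when (d * e ≟ y) (K d e ⊗ Φ y)))
    distribute y = trans (sym (sumTo-*ʳ n (Φ y) _)) (sumTo-cong n (λ d _ _ →
      trans (sym (sumTo-*ʳ n (Φ y) _)) (sumTo-cong n (λ e _ _ → when-*ʳ (d * e ≟ y) (K d e) (Φ y)))))

  countResidue01 : ℕ → ℕ → ℕ → C
  countResidue01 n d e = sumTo n (λ a → when (residue01? d e a) 1#)

  countResidue01-periods : ∀ {d e} → 1 ≤ d → 1 ≤ e → Coprime d e → ∀ q → countResidue01 (q * (d * e)) d e ≈ fromℕ q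
  countResidue01-periods {d} {e} 1≤d 1≤e d⊥e = periods
    where
    open CoprimeResidue01 1≤d 1≤e d⊥e
    I : ℕ → C
    I a = when (residue01? d e a) 1#
    onePeriod : countResidue01 L d e ≈ 1#
    onePeriod with residue01-inPeriod
    ... | a , 1≤a , a≤L , r = trans (sumTo-single a I 1≤a a≤L (λ i 1≤i i≤L i≢a → when-no (residue01? d e i)
                                      (λ ri → i≢a (residue01-unique 1≤i 1≤a i≤L a≤L ri r))))
                                    (when-yes (residue01? d e a) r)
    shift : ∀ {j} → 1 ≤ j → I (L + j) ≈ I j
    shift {j} 1≤j = when-⇔ (residue01? d e (L + j)) (residue01? d e j) to from
      where open Equivalence (residue01-periodic 1≤j)
    periods : ∀ q → countResidue01 (q * L) d e ≈ fromℕ q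
    periods zero    = refl
    periods (suc q) = begin
      sumTo (L + q * L) I                          ≈⟨ sumTo-+ L (q * L) I ⟩
      sumTo L I ⊕ sumTo (q * L) (λ j → I (L + j))  ≈⟨ ⊕-cong onePeriod (sumTo-cong (q * L) (λ j 1≤j _ → shift 1≤j)) ⟩
      1# ⊕ sumTo (q * L) I                         ≈⟨ ⊕-congˡ (periods q) ⟩
      1# ⊕ fromℕ q                                 ∎

  countResidue01-∣ : ∀ {n d e} → 1 ≤ n → 1 ≤ d → 1 ≤ e → d ∣ n → e ∣ n →
    countResidue01 n d e ≈ when (gcd d e ≟ 1) (cofactor idA n (d * e))
  countResidue01-∣ {n} {d} {e} 1≤n 1≤d 1≤e d∣n e∣n with gcd d e ≟ 1
  ... | no gcd≢1 = sumTo-ε n (λ a 1≤a _ → when-no (residue01? d e a) (λ r → gcd≢1 (residue01⇒gcd≡1 1≤a r)))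
  ... | yes gcd≡1 with coprime⇒*∣ (gcd≡1⇒coprime gcd≡1) d∣n e∣n
  ...   | divides q n≡q*de = begin
    countResidue01 n d e            ≡⟨ ≡.cong (λ t → countResidue01 t d e) n≡q*de ⟩
    countResidue01 (q * (d * e)) d e ≈⟨ countResidue01-periods 1≤d 1≤e (gcd≡1⇒coprime gcd≡1) q ⟩
    fromℕ q                         ≈⟨ cofactor-∣ idA {q = q} 1≤n n≡q*de ⟨
    cofactor idA n (d * e)          ∎

  countResidue01-weighted : ∀ {n d e} → 1 ≤ n → 1 ≤ d → 1 ≤ e → ∀ X →
    when (d ∣? n) (when (e ∣? n) X) ⊗ countResidue01 n d e ≈ when (gcd d e ≟ 1) X ⊗ cofactor idA n (d * e)
  countResidue01-weighted {n} {d} {e} 1≤n 1≤d 1≤e X with d ∣? n | e ∣? n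
  ... | yes d∣n | yes e∣n = begin
    X ⊗ countResidue01 n d e                            ≈⟨ ⊗-congˡ (countResidue01-∣ 1≤n 1≤d 1≤e d∣n e∣n) ⟩
    X ⊗ when (gcd d e ≟ 1) (cofactor idA n (d * e))     ≈⟨ when-*ˡ (gcd d e ≟ 1) _ X ⟩
    when (gcd d e ≟ 1) (X ⊗ cofactor idA n (d * e))     ≈⟨ when-*ʳ (gcd d e ≟ 1) X _ ⟨
    when (gcd d e ≟ 1) X ⊗ cofactor idA n (d * e)       ∎
  ... | yes _   | no e∤n  = trans (zeroˡ _) (sym (trans (⊗-congˡ (cofactor-∤ idA (e∤n ∘ m*n∣⇒n∣ d e))) (zeroʳ _)))
  ... | no d∤n  | _       = trans (zeroˡ _) (sym (trans (⊗-congˡ (cofactor-∤ idA (d∤n ∘ m*n∣⇒m∣ d e))) (zeroʳ _)))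

  M-expansion : ∀ (f : ArithFun) {n} → 1 ≤ n →
    M f n ≈ sumTo n (λ d → sumTo n (λ e → when (gcd d e ≟ 1) (μA d ⊗ (μA ⋆ f) e) ⊗ cofactor idA n (d * e)))
  M-expansion f {n} 1≤n = begin
    M f n
      ≈⟨ M-sumTo f n ⟩
    sumTo n (λ a → when (gcd a n ≟ 1) (f (gcd (a ∸ 1) n)))
      ≈⟨ sumTo-cong n (λ a _ _ → trans (sym (when-1⊗ (gcd a n ≟ 1) _))
           (⊗-cong (coprimality-as-μ-sum a 1≤n) (gcd-as-μ⋆-sum f (a ∸ 1) 1≤n))) ⟩
    sumTo n (λ a → sumTo n (P a) ⊗ sumTo n (Q a))
      ≈⟨ sumTo-cong n (λ a _ _ → sumTo-*-sumTo n n (P a) (Q a)) ⟩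
    sumTo n (λ a → sumTo n (λ d → sumTo n (λ e → P a d ⊗ Q a e)))
      ≈⟨ sumTo-rotate n _ ⟩
    sumTo n (λ d → sumTo n (λ e → sumTo n (λ a → P a d ⊗ Q a e)))
      ≈⟨ sumTo-cong n (λ d _ _ → sumTo-cong n (λ e _ _ → trans
           (sumTo-cong n (λ a _ _ → when-interchange (d ∣? n) (d ∣? a) (e ∣? n) (e ∣? a ∸ 1) (μA d) (g e)))
           (sumTo-*ˡ n _ _))) ⟩
    sumTo n (λ d → sumTo n (λ e → when (d ∣? n) (when (e ∣? n) (μA d ⊗ g e)) ⊗ countResidue01 n d e))
      ≈⟨ sumTo-cong n (λ d 1≤d _ → sumTo-cong n (λ e 1≤e _ → countResidue01-weighted 1≤n 1≤d 1≤e _)) ⟩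
    sumTo n (λ d → sumTo n (λ e → when (gcd d e ≟ 1) (μA d ⊗ g e) ⊗ cofactor idA n (d * e)))
      ∎
    where
    g : ArithFun
    g = μA ⋆ f
    P : ℕ → ℕ → C
    P a d = when (d ∣? n) (when (d ∣? a) (μA d))
    Q : ℕ → ℕ → C
    Q a e = when (e ∣? n) (when (e ∣? a ∸ 1) (g e))

  idA⋆⊠-expansion : ∀ (g : ArithFun) {n} → 1 ≤ n →
    (idA ⋆ (μA ⊠ g)) n ≈ sumTo n (λ d → sumTo n (λ e → when (gcd d e ≟ 1) (μA d ⊗ g e) ⊗ cofactor idA n (d * e)))
  idA⋆⊠-expansion g {n} 1≤n = begin
    (idA ⋆ (μA ⊠ g)) n
      ≈⟨ ⋆-cofactor idA (μA ⊠ g) n ⟩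
    sumTo n (λ y → (μA ⊠ g) y ⊗ cofactor idA n y)
      ≈⟨ sumTo-cong n (λ y _ y≤n → ⊗-congʳ (trans (⊠-sumTo μA g y) (factorPairSum-extend K y≤n))) ⟩
    sumTo n (λ y → sumTo n (λ d → sumTo n (λ e → when (d * e ≟ y) (K d e))) ⊗ cofactor idA n y)
      ≈⟨ factorPairSum-collapse K (cofactor idA n)
           (λ y n<y → cofactor-∤ idA (λ y∣n → <⇒≱ n<y (∣⇒≤ {{>-nonZero 1≤n}} y∣n))) ⟩
    sumTo n (λ d → sumTo n (λ e → K d e ⊗ cofactor idA n (d * e)))
      ∎
    where
    K : ℕ → ℕ → C
    K d e = when (gcd d e ≟ 1) (μA d ⊗ g e)

mainTheorem4 : ∀ {c ℓ} (R : CommutativeRing c ℓ) (f : ℕ → CommutativeRing.Carrier R) (n : ℕ) →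
    1 ≤ n →
    CommutativeRing._≈_ R (Arith.M R f n)
      (Arith._⋆_ R (Arith.idA R) (Arith._⊠_ R (Arith.μA R) (Arith._⋆_ R (Arith.μA R) f)) n)
mainTheorem4 R f n 1≤n = trans (M-expansion f 1≤n) (sym (idA⋆⊠-expansion (μA ⋆ f) 1≤n))
  where
  open CommutativeRing R using (trans; sym)
  open Arith R using (μA; _⋆_)
  open ArithmeticFunctions R using (M-expansion; idA⋆⊠-expansion)
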